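{- There is an algorithm that, given integers $p, q \ge 1$, decides whether there exist antipalindromic numbers $A, B$ with $p/q = A/B$.
   Context: A positive integer is antipalindromic if its base-$2$ representation (without leading zeros) $w_1 \cdots w_{2m}$ has even length and satisfies $w_i + w_{2m+1-i} = 1$ for all $i$ (the second half is the reverse complement of the first half). -}

module Defs where

open import Data.Nat using (ℕ; zero; suc; _+_; _*_; _∸_; _≤_; _<_; _%_; _/_)
open import Data.List using (List; []; _∷_; _++_; [_]; length)
open import Data.Product using (Σ; _×_)
open import Relation.Binary.PropositionalEquality using (_≡_)

-- Base-2 digits of n, most significant first, without leading zeros
-- (binary 0 = []). The first argument is fuel; fuel n suffices for n.
binaryAux : ℕ → ℕ → List ℕ
binaryAux zero    _ = []
binaryAux (suc f) zero = []
binaryAux (suc f) (suc n) = binaryAux f (suc n / 2) ++ [ suc n % 2 ]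

binary : ℕ → List ℕ
binary n = binaryAux n n

-- 0-indexed lookup with default 0 (only used for in-range indices)
nth : List ℕ → ℕ → ℕ
nth []       _       = 0
nth (x ∷ xs) zero    = x
nth (x ∷ xs) (suc i) = nth xs i

-- n is antipalindromic: n ≥ 1 and its binary word w_1 … w_{2m} has even
-- length with w_i + w_{2m+1-i} = 1 for all i (here 0-indexed:
-- w[i] + w[2m-1-i] = 1 for i < 2m).
Antipalindromic : ℕ → Set
Antipalindromic n =
  1 ≤ n × Σ ℕ (λ m → length (binary n) ≡ 2 * m ×
    ((i : ℕ) → i < 2 * m → nth (binary n) i + nth (binary n) (2 * m ∸ 1 ∸ i) ≡ 1))

module Submission where

-- An antipalindromic number is determined by the first half of its binary word, a list
-- true ∷ h of bits, and has value antiVal (true ∷ h).  If A and B are antipalindromic with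
-- halves of lengths n and n + d and q A = p B, comparing leading powers of 4 gives d < 2q;
-- so only finitely many length gaps d matter.  For fixed d, read the halves of A and B in
-- parallel from the outside in, one pair of digits at a time: the equation q A = p B then
-- becomes a run of a transducer whose state (H , C) holds the weight H of the leading digits
-- read so far and the carry C of the trailing ones.  Every state from which such a run can be
-- completed lies in the finite box -q ≤ H ≤ p 4^d, -p ≤ C ≤ q, so solvability is reachability
-- in a finite graph, which is decided by searching runs no longer than the size of the box.

open import Defs
open import Data.List using (List)
open import Data.Nat using (ℕ)
open import Relation.Binary.Definitions using (DecidableEquality)
open import Relation.Nullary using (Dec)

module Lists where

  open import Data.Bool using (Bool; true; false)
  open import Data.List using ([]; _∷_; _++_; _∷ʳ_; length)
  open import Data.List.Membership.Propositional using (_∉_)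
  open import Data.List.Membership.Propositional.Properties using (∈-∃++; ∈-++⁻; ∈-++⁺ˡ; ∈-++⁺ʳ)
  open import Data.List.Properties using (length-++; length-++-sucʳ)
  open import Data.List.Relation.Binary.Subset.Propositional using (_⊆_)
  open import Data.List.Relation.Unary.Any using (here; there)
  open import Data.List.Relation.Unary.AllPairs using (_∷_)
  open import Data.List.Relation.Unary.Unique.Propositional using (Unique)
  open import Data.List.Relation.Unary.Unique.Propositional.Properties using (Unique[x∷xs]⇒x∉xs)
  open import Data.Nat using (zero; suc; _≤_; z≤n; s≤s)
  open import Data.Nat.Properties using (+-comm; suc-injective)
  open import Data.Product using (∃; _×_; _,_)
  open import Data.Sum using (inj₁; inj₂)
  open import Function using (_∘_)
  open import Relation.Binary.PropositionalEquality using (_≡_; refl; cong; subst; sym; trans)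
  open import Relation.Nullary using (Dec; contradiction)
  open import Relation.Nullary.Decidable using (map′; _⊎-dec_)
  open import Relation.Unary using (Decidable)

  ∃-Bool? : ∀ {p} {P : Bool → Set p} → Decidable P → Dec (∃ P)
  ∃-Bool? P? = map′ (λ { (inj₁ h) → true , h ; (inj₂ h) → false , h })
                    (λ { (true , h) → inj₁ h ; (false , h) → inj₂ h })
                    (P? true ⊎-dec P? false)

  ∃-ofLength? : ∀ {p} {P : List Bool → Set p} → Decidable P →
    ∀ n → Dec (∃ λ l → length l ≡ n × P l)
  ∃-ofLength? P? zero = map′ (λ h → [] , refl , h) (λ { ([] , _ , h) → h }) (P? [])
  ∃-ofLength? P? (suc n) =
    map′ (λ (a , l , len , h) → a ∷ l , cong suc len , h)
         (λ { (a ∷ l , refl , h) → a , l , refl , h })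
         (∃-Bool? λ a → ∃-ofLength? (P? ∘ (a ∷_)) n)

  unique-⊆⇒length≤ : ∀ {a} {A : Set a} {xs ys : List A} → Unique xs → xs ⊆ ys → length xs ≤ length ys
  unique-⊆⇒length≤ {xs = []} _ _ = z≤n
  unique-⊆⇒length≤ {xs = x ∷ xs} u@(_ ∷ u-xs) xs⊆ys with ∈-∃++ (xs⊆ys (here refl))
  ... | ys₁ , ys₂ , refl = subst (suc (length xs) ≤_) (sym (length-++-sucʳ ys₁ x ys₂))
    (s≤s (unique-⊆⇒length≤ u-xs xs⊆ys₁++ys₂))
    where
    x∉xs : x ∉ xs
    x∉xs = Unique[x∷xs]⇒x∉xs u
    xs⊆ys₁++ys₂ : xs ⊆ ys₁ ++ ys₂
    xs⊆ys₁++ys₂ {z} z∈xs with ∈-++⁻ ys₁ (xs⊆ys (there z∈xs))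
    ... | inj₁ z∈ys₁ = ∈-++⁺ˡ z∈ys₁
    ... | inj₂ (here refl) = contradiction z∈xs x∉xs
    ... | inj₂ (there z∈ys₂) = ∈-++⁺ʳ ys₁ z∈ys₂

  length-∷ʳ : ∀ {a} {A : Set a} (xs : List A) x → length (xs ∷ʳ x) ≡ suc (length xs)
  length-∷ʳ xs x = trans (length-++ xs) (+-comm _ 1)

  length-∷-∷ʳ⁻¹ : ∀ {a} {A : Set a} (x : A) w y {n} → length (x ∷ w ∷ʳ y) ≡ suc (suc n) → length w ≡ n
  length-∷-∷ʳ⁻¹ x w y len = suc-injective (suc-injective (trans (cong suc (sym (length-∷ʳ w y))) len))

module FiniteSearch {S : Set} (_≟_ : DecidableEquality S)
  (Step : S → S → Set) (Step? : ∀ s t → Dec (Step s t))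
  (Final : S → Set) (Final? : ∀ s → Dec (Final s))
  (space : List S) where

  open import Data.List using ([]; _∷_; length)
  open import Data.List.Membership.Propositional using (_∈_; find; lose)
  open import Data.List.Relation.Binary.Subset.Propositional using (_⊆_)
  open import Data.List.Relation.Unary.All using ([]; _∷_)
  open import Data.List.Relation.Unary.All.Properties using (¬Any⇒All¬)
  open import Data.List.Relation.Unary.AllPairs using ([]; _∷_)
  open import Data.List.Relation.Unary.Any using (Any; here; there; any?)
  open import Data.List.Relation.Unary.Unique.Propositional using (Unique)
  open import Data.Nat using (zero; suc; _≤_; _<_; s≤s)
  open import Data.Nat.Properties using (anyUpTo?)
  open import Data.Product using (∃; Σ; _×_; _,_)
  open import Relation.Binary.PropositionalEquality using (_≡_; refl; cong; subst)
  open import Relation.Nullary using (yes; no)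
  open import Relation.Nullary.Decidable using (map′; _×-dec_)
  open Lists using (unique-⊆⇒length≤)

  data Run : S → ℕ → Set where
    done : ∀ {s} → Final s → Run s 0
    step : ∀ {s t n} → Step s t → t ∈ space → Run t n → Run s (suc n)

  visited : ∀ {s n} → Run s n → List S
  visited (done _) = []
  visited (step {t = t} _ _ r) = t ∷ visited r

  length-visited : ∀ {s n} (r : Run s n) → length (visited r) ≡ n
  length-visited (done _) = refl
  length-visited (step _ _ r) = cong suc (length-visited r)

  visited⊆space : ∀ {s n} (r : Run s n) → visited r ⊆ space
  visited⊆space (step _ t∈ _) (here refl) = t∈
  visited⊆space (step _ _ r) (there v∈) = visited⊆space r v∈

  SimpleRun : S → Set
  SimpleRun s = ∃ λ n → Σ (Run s n) λ r → Unique (s ∷ visited r)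

  simpleRun-from : ∀ {s t n} (r : Run t n) → Unique (t ∷ visited r) → s ∈ t ∷ visited r → SimpleRun s
  simpleRun-from r u (here refl) = _ , r , u
  simpleRun-from (step _ _ r) (_ ∷ u) (there s∈) = simpleRun-from r u s∈

  simplify : ∀ {s n} → Run s n → SimpleRun s
  simplify (done f) = 0 , done f , [] ∷ []
  simplify {s} (step st t∈ r) with simplify r
  ... | n , r′ , u with any? (s ≟_) (_ ∷ visited r′)
  ...   | yes s∈ = simpleRun-from r′ u s∈
  ...   | no s∉ = suc n , step st t∈ r′ , ¬Any⇒All¬ _ s∉ ∷ u

  run? : ∀ n s → Dec (Run s n)
  run? zero s = map′ done (λ { (done f) → f }) (Final? s)
  run? (suc n) s = map′ fromAny toAny (any? (λ t → Step? s t ×-dec run? n t) space)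
    where
    fromAny : Any (λ t → Step s t × Run t n) space → Run s (suc n)
    fromAny a with _ , t∈ , st , r ← find a = step st t∈ r
    toAny : Run s (suc n) → Any (λ t → Step s t × Run t n) space
    toAny (step st t∈ r) = lose t∈ (st , r)

  ∃run? : ∀ s → Dec (∃ (Run s))
  ∃run? s = map′ (λ (n , _ , r) → n , r) shorten (anyUpTo? (λ n → run? n s) (suc (length space)))
    where
    shorten : ∃ (Run s) → ∃ λ n → n < suc (length space) × Run s n
    shorten (_ , r) with simplify r
    ... | n , r′ , _ ∷ u = n , s≤s (subst (_≤ length space) (length-visited r′)
                               (unique-⊆⇒length≤ u (visited⊆space r′))) , r′

module Binary where

  open import Data.Bool using (Bool; true; false)
  open import Data.List using ([]; _∷_; _∷ʳ_; length; foldl)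
  open import Data.List.Properties using (foldl-∷ʳ)
  open import Data.List.Relation.Unary.All using (All)
  open import Data.List.Relation.Unary.All.Properties using (∷ʳ⁻)
  open import Data.List.Reverse using (reverseView; []; _∶_∶ʳ_)
  open import Data.Nat using (zero; suc; _+_; _*_; _^_; _≤_; _<_; _/_; _%_; z≤n; s≤s; >-nonZero)
  open import Data.Nat.DivMod
    using (m≡m%n+[m/n]*n; m/n<m; m≥n⇒m/n>0; m*n/n≡m; m<n⇒m/n≡0; m<n⇒m%n≡m; +-distrib-/-∣ˡ; %-remove-+ˡ)
  open import Data.Nat.Divisibility using (n∣m*n)
  open import Data.Nat.Properties
  open import Data.Nat.Tactic.RingSolver using (solve-∀)
  open import Data.Product using (∃; _,_)
  open import Relation.Binary.PropositionalEquality
  open import Relation.Nullary using (contradiction)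

  bit : Bool → ℕ
  bit true = 1
  bit false = 0

  fromBits : List ℕ → ℕ
  fromBits = foldl (λ acc x → acc * 2 + x) 0

  fromBits-∷ʳ : ∀ xs x → fromBits (xs ∷ʳ x) ≡ fromBits xs * 2 + x
  fromBits-∷ʳ xs x = foldl-∷ʳ _ 0 x xs

  fromBits-∷ : ∀ x xs → fromBits (x ∷ xs) ≡ x * 2 ^ length xs + fromBits xs
  fromBits-∷ x xs = foldl-from x xs
    where
    foldl-from : ∀ acc xs → foldl (λ acc x → acc * 2 + x) acc xs ≡ acc * 2 ^ length xs + fromBits xs
    foldl-from acc [] = sym (trans (+-identityʳ _) (*-identityʳ acc))
    foldl-from acc (y ∷ ys) = begin
      foldl _ (acc * 2 + y) ys               ≡⟨ foldl-from (acc * 2 + y) ys ⟩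
      (acc * 2 + y) * 2 ^ length ys + fromBits ys
        ≡⟨ distrib acc y (2 ^ length ys) (fromBits ys) ⟩
      acc * (2 * 2 ^ length ys) + (y * 2 ^ length ys + fromBits ys)
        ≡⟨ cong (acc * (2 * 2 ^ length ys) +_) (foldl-from y ys) ⟨
      acc * (2 * 2 ^ length ys) + fromBits (y ∷ ys) ∎
      where
      open ≡-Reasoning
      distrib : ∀ a y t r → (a * 2 + y) * t + r ≡ a * (2 * t) + (y * t + r)
      distrib = solve-∀

  1≤fromBits-1∷ : ∀ xs → 1 ≤ fromBits (1 ∷ xs)
  1≤fromBits-1∷ xs = subst (1 ≤_) (sym (fromBits-∷ 1 xs))
    (≤-trans (subst (1 ≤_) (sym (*-identityˡ _)) (m^n>0 2 (length xs))) (m≤m+n _ _))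

  [2e+b]/2≡e : ∀ e {b} → b < 2 → (e * 2 + b) / 2 ≡ e
  [2e+b]/2≡e e {b} b<2 = begin
    (e * 2 + b) / 2   ≡⟨ +-distrib-/-∣ˡ b (n∣m*n e) ⟩
    e * 2 / 2 + b / 2 ≡⟨ cong₂ _+_ (m*n/n≡m e 2) (m<n⇒m/n≡0 b<2) ⟩
    e + 0             ≡⟨ +-identityʳ e ⟩
    e                 ∎
    where open ≡-Reasoning

  [2e+b]%2≡b : ∀ e {b} → b < 2 → (e * 2 + b) % 2 ≡ b
  [2e+b]%2≡b e b<2 = trans (%-remove-+ˡ _ (n∣m*n e)) (m<n⇒m%n≡m b<2)

  fromBits-binaryAux : ∀ f n → n ≤ f → fromBits (binaryAux f n) ≡ n
  fromBits-binaryAux zero zero _ = refl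
  fromBits-binaryAux (suc f) zero _ = refl
  fromBits-binaryAux (suc f) (suc n) (s≤s n≤f) = begin
    fromBits (binaryAux f (suc n / 2) ∷ʳ suc n % 2)
      ≡⟨ fromBits-∷ʳ (binaryAux f (suc n / 2)) (suc n % 2) ⟩
    fromBits (binaryAux f (suc n / 2)) * 2 + suc n % 2
      ≡⟨ cong (λ h → h * 2 + suc n % 2) (fromBits-binaryAux f (suc n / 2) half≤f) ⟩
    suc n / 2 * 2 + suc n % 2
      ≡⟨ +-comm _ (suc n % 2) ⟩
    suc n % 2 + suc n / 2 * 2
      ≡⟨ m≡m%n+[m/n]*n (suc n) 2 ⟨
    suc n ∎
    where
    open ≡-Reasoning
    half≤f : suc n / 2 ≤ f
    half≤f = ≤-trans (<⇒≤pred (m/n<m (suc n) 2 (s≤s (s≤s z≤n)))) n≤f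

  binaryAux-0 : ∀ f → binaryAux f 0 ≡ []
  binaryAux-0 zero = refl
  binaryAux-0 (suc f) = refl

  binaryAux-suc : ∀ f {n} → 1 ≤ n → binaryAux (suc f) n ≡ binaryAux f (n / 2) ∷ʳ n % 2
  binaryAux-suc f {suc n} _ = refl

  binaryAux-fromBits : ∀ f ds → All (_< 2) ds → fromBits (1 ∷ ds) ≤ f →
    binaryAux f (fromBits (1 ∷ ds)) ≡ 1 ∷ ds
  binaryAux-fromBits zero ds _ n≤0 = contradiction (≤-trans (1≤fromBits-1∷ ds) n≤0) λ ()
  binaryAux-fromBits (suc f) ds bits n≤f with reverseView ds
  ... | [] = cong (_∷ʳ 1) (binaryAux-0 f)
  ... | ini ∶ _ ∶ʳ x with ∷ʳ⁻ bits
  ...   | bits-ini , x<2 = begin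
    binaryAux (suc f) (fromBits ((1 ∷ ini) ∷ʳ x))
      ≡⟨ cong (binaryAux (suc f)) (fromBits-∷ʳ (1 ∷ ini) x) ⟩
    binaryAux (suc f) (e * 2 + x)
      ≡⟨ binaryAux-suc f (≤-trans 1≤e (≤-trans (m≤m*n e 2) (m≤m+n _ x))) ⟩
    binaryAux f ((e * 2 + x) / 2) ∷ʳ (e * 2 + x) % 2
      ≡⟨ cong₂ (λ u v → binaryAux f u ∷ʳ v) ([2e+b]/2≡e e x<2) ([2e+b]%2≡b e x<2) ⟩
    binaryAux f e ∷ʳ x
      ≡⟨ cong (_∷ʳ x) (binaryAux-fromBits f ini bits-ini e≤f) ⟩
    (1 ∷ ini) ∷ʳ x ∎
    where
    open ≡-Reasoning
    e = fromBits (1 ∷ ini)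
    1≤e : 1 ≤ e
    1≤e = 1≤fromBits-1∷ ini
    e≤f : e ≤ f
    e≤f = ≤-pred (<-≤-trans (m<m*n e 2 ⦃ >-nonZero 1≤e ⦄ (s≤s (s≤s z≤n)))
            (≤-trans (m≤m+n _ x) (subst (_≤ suc f) (fromBits-∷ʳ (1 ∷ ini) x) n≤f)))

  binaryAux-head : ∀ f n → 1 ≤ n → n ≤ f → ∃ λ ds → binaryAux f n ≡ 1 ∷ ds
  binaryAux-head (suc f) 1 _ _ = [] , cong (_∷ʳ 1) (binaryAux-0 f)
  binaryAux-head (suc f) n@(suc (suc m)) _ (s≤s 1+m≤f)
    with ds , eq ← binaryAux-head f (n / 2) (m≥n⇒m/n>0 {n} {2} (s≤s (s≤s z≤n)))
                     (≤-trans (<⇒≤pred (m/n<m n 2 (s≤s (s≤s z≤n)))) 1+m≤f)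
    = ds ∷ʳ n % 2 , cong (_∷ʳ n % 2) eq

module Antipalindromes where

  open Binary
  open Lists using (length-∷ʳ; length-∷-∷ʳ⁻¹)
  open import Data.Bool using (Bool; true; false; not)
  open import Data.List using ([]; _∷_; _∷ʳ_; length)
  open import Data.List.Relation.Unary.All using (All; []; _∷_)
  open import Data.List.Relation.Unary.All.Properties using (∷ʳ⁺)
  open import Data.List.Reverse using (Reverse; reverseView; []; _∶_∶ʳ_)
  open import Data.Nat using (zero; suc; _+_; _*_; _∸_; _^_; _≤_; _<_; z≤n; s≤s)
  open import Data.Nat.Properties
  open import Data.Nat.Tactic.RingSolver using (solve-∀)
  open import Data.Product using (∃; _×_; _,_)
  open import Data.Sum using (inj₁; inj₂)
  open import Relation.Binary.PropositionalEquality

  nth-∷ʳ-init : ∀ w y {i} → i < length w → nth (w ∷ʳ y) i ≡ nth w i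
  nth-∷ʳ-init (x ∷ w) y {zero} _ = refl
  nth-∷ʳ-init (x ∷ w) y {suc i} (s≤s i<n) = nth-∷ʳ-init w y i<n

  nth-∷ʳ-last : ∀ w y {n} → length w ≡ n → nth (w ∷ʳ y) n ≡ y
  nth-∷ʳ-last [] y refl = refl
  nth-∷ʳ-last (x ∷ w) y refl = nth-∷ʳ-last w y refl

  bit<2 : ∀ a → bit a < 2
  bit<2 true = s≤s (s≤s z≤n)
  bit<2 false = s≤s z≤n

  bit+bit-not : ∀ a → bit a + bit (not a) ≡ 1
  bit+bit-not true = refl
  bit+bit-not false = refl

  +≡1⇒bits : ∀ x y → x + y ≡ 1 → ∃ λ a → x ≡ bit a × y ≡ bit (not a)
  +≡1⇒bits 0 1 refl = false , refl , refl
  +≡1⇒bits 1 0 refl = true , refl , refl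

  Complementary : ℕ → List ℕ → Set
  Complementary n w = ∀ i → i < n → nth w i + nth w (n ∸ 1 ∸ i) ≡ 1

  complementary-inner : ∀ x w y {n i} → length w ≡ n → i < n →
    nth (x ∷ w ∷ʳ y) (suc i) + nth (x ∷ w ∷ʳ y) (suc (suc n) ∸ 1 ∸ suc i)
      ≡ nth w i + nth w (n ∸ 1 ∸ i)
  complementary-inner x w y {suc k} {i} len i<n@(s≤s i≤k) =
    cong₂ _+_ (init i<n) (begin
      nth (x ∷ w ∷ʳ y) (suc k ∸ i)   ≡⟨ cong (nth (x ∷ w ∷ʳ y)) (+-∸-assoc 1 i≤k) ⟩
      nth (w ∷ʳ y) (k ∸ i)           ≡⟨ init (s≤s (m∸n≤m k i)) ⟩
      nth w (k ∸ i)                  ∎)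
    where
    open ≡-Reasoning
    init : ∀ {j} → j < suc k → nth (w ∷ʳ y) j ≡ nth w j
    init j<n = nth-∷ʳ-init w y (subst (_ <_) (sym len) j<n)

  complementary-wrap : ∀ x w y {n} → length w ≡ n → x + y ≡ 1 → Complementary n w →
    Complementary (suc (suc n)) (x ∷ w ∷ʳ y)
  complementary-wrap x w y len x+y≡1 _ zero _ = trans (cong (x +_) (nth-∷ʳ-last w y len)) x+y≡1
  complementary-wrap x w y {n} len x+y≡1 comp (suc i) (s≤s i<1+n) with m<1+n⇒m<n∨m≡n i<1+n
  ... | inj₁ i<n = trans (complementary-inner x w y len i<n) (comp i i<n)
  ... | inj₂ refl = begin
    nth (w ∷ʳ y) n + nth (x ∷ w ∷ʳ y) (n ∸ n)
      ≡⟨ cong₂ _+_ (nth-∷ʳ-last w y len) (cong (nth (x ∷ w ∷ʳ y)) (n∸n≡0 n)) ⟩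
    y + x                                    ≡⟨ +-comm y x ⟩
    x + y                                    ≡⟨ x+y≡1 ⟩
    1                                        ∎
    where open ≡-Reasoning

  complementary-unwrap : ∀ x w y {n} → length w ≡ n → Complementary (suc (suc n)) (x ∷ w ∷ʳ y) →
    x + y ≡ 1 × Complementary n w
  complementary-unwrap x w y len comp =
    trans (cong (x +_) (sym (nth-∷ʳ-last w y len))) (comp 0 (s≤s z≤n)) ,
    λ i i<n → trans (sym (complementary-inner x w y len i<n)) (comp (suc i) (s≤s (m≤n⇒m≤1+n i<n)))

  antiWord : List Bool → List ℕ
  antiWord [] = []
  antiWord (a ∷ h) = bit a ∷ antiWord h ∷ʳ bit (not a)

  length-antiWord : ∀ h → length (antiWord h) ≡ 2 * length h
  length-antiWord [] = refl
  length-antiWord (a ∷ h) = trans (cong suc (trans (length-∷ʳ (antiWord h) _) (cong suc (length-antiWord h))))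
    (sym (*-suc 2 (length h)))

  antiWord-bits : ∀ h → All (_< 2) (antiWord h)
  antiWord-bits [] = []
  antiWord-bits (a ∷ h) = bit<2 a ∷ ∷ʳ⁺ (antiWord-bits h) (bit<2 (not a))

  antiWord-complementary : ∀ h → Complementary (2 * length h) (antiWord h)
  antiWord-complementary [] _ ()
  antiWord-complementary (a ∷ h) = subst (λ n → Complementary n (antiWord (a ∷ h))) (sym (*-suc 2 (length h)))
    (complementary-wrap (bit a) (antiWord h) (bit (not a)) (length-antiWord h) (bit+bit-not a) (antiWord-complementary h))

  complementary⇒antiWord : ∀ m w → length w ≡ 2 * m → Complementary (2 * m) w →
    ∃ λ h → length h ≡ m × antiWord h ≡ w
  complementary⇒antiWord zero [] _ _ = [] , refl , refl
  complementary⇒antiWord (suc m) (x ∷ w) len comp =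
    peel (reverseView w) (trans len (*-suc 2 m)) (subst (λ n → Complementary n (x ∷ w)) (*-suc 2 m) comp)
    where
    peel : ∀ {w} → Reverse w → length (x ∷ w) ≡ suc (suc (2 * m)) →
      Complementary (suc (suc (2 * m))) (x ∷ w) → ∃ λ h → length h ≡ suc m × antiWord h ≡ x ∷ w
    peel [] ()
    peel (mid ∶ _ ∶ʳ y) len comp
      with x+y≡1 , comp-mid ← complementary-unwrap x mid y (length-∷-∷ʳ⁻¹ x mid y len) comp
      with a , refl , refl ← +≡1⇒bits x y x+y≡1
      with h , refl , refl ← complementary⇒antiWord m mid (length-∷-∷ʳ⁻¹ x mid y len) comp-mid
      = a ∷ h , refl , refl

  antiVal : List Bool → ℕ
  antiVal [] = 0
  antiVal (a ∷ h) = bit a * (2 * 4 ^ length h) + 2 * antiVal h + bit (not a)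

  fromBits-antiWord : ∀ h → fromBits (antiWord h) ≡ antiVal h
  fromBits-antiWord [] = refl
  fromBits-antiWord (a ∷ h) = begin
    fromBits (bit a ∷ antiWord h ∷ʳ bit (not a))
      ≡⟨ fromBits-∷ (bit a) (antiWord h ∷ʳ bit (not a)) ⟩
    bit a * 2 ^ length (antiWord h ∷ʳ bit (not a)) + fromBits (antiWord h ∷ʳ bit (not a))
      ≡⟨ cong₂ (λ k v → bit a * 2 ^ k + v) (trans (length-∷ʳ (antiWord h) _) (cong suc (length-antiWord h)))
               (fromBits-∷ʳ (antiWord h) (bit (not a))) ⟩
    bit a * (2 * 2 ^ (2 * length h)) + (fromBits (antiWord h) * 2 + bit (not a))
      ≡⟨ cong₂ (λ u v → bit a * (2 * u) + (v * 2 + bit (not a)))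
               (sym (^-*-assoc 2 2 (length h))) (fromBits-antiWord h) ⟩
    bit a * (2 * 4 ^ length h) + (antiVal h * 2 + bit (not a))
      ≡⟨ reassoc (bit a * (2 * 4 ^ length h)) (antiVal h) (bit (not a)) ⟩
    antiVal (a ∷ h) ∎
    where
    open ≡-Reasoning
    reassoc : ∀ x v b → x + (v * 2 + b) ≡ x + 2 * v + b
    reassoc = solve-∀

  binary-antiVal : ∀ h → binary (antiVal (true ∷ h)) ≡ antiWord (true ∷ h)
  binary-antiVal h = subst (λ n → binaryAux n n ≡ antiWord (true ∷ h)) (fromBits-antiWord (true ∷ h))
    (binaryAux-fromBits _ (antiWord h ∷ʳ 0) (∷ʳ⁺ (antiWord-bits h) (s≤s z≤n)) ≤-refl)

  2*4^length≤antiVal : ∀ h → 2 * 4 ^ length h ≤ antiVal (true ∷ h)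
  2*4^length≤antiVal h = subst (2 * 4 ^ length h ≤_) (normalise (4 ^ length h) (antiVal h)) (m≤m+n _ _)
    where
    normalise : ∀ x v → 2 * x + 2 * v ≡ 1 * (2 * x) + 2 * v + 0
    normalise = solve-∀

  antiVal<4^length : ∀ h → antiVal h < 4 ^ length h
  antiVal<4^length [] = s≤s z≤n
  antiVal<4^length (a ∷ h) = begin-strict
    antiVal (a ∷ h)     <⟨ outer-digits a (4 ^ length h) (antiVal h) ⟩
    2 * X + 2 * suc (antiVal h) ≤⟨ +-monoʳ-≤ (2 * X) (*-monoʳ-≤ 2 (antiVal<4^length h)) ⟩
    2 * X + 2 * X       ≡⟨ double X ⟩
    4 * X               ∎
    where
    open ≤-Reasoning
    X = 4 ^ length h
    double : ∀ X → 2 * X + 2 * X ≡ 4 * X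
    double = solve-∀
    outer-digits : ∀ a X v → bit a * (2 * X) + 2 * v + bit (not a) < 2 * X + 2 * suc v
    outer-digits true X v = subst (_< 2 * X + 2 * suc v) (sym (lhs X v))
      (+-monoʳ-< (2 * X) (*-monoʳ-< 2 (n<1+n v)))
      where
      lhs : ∀ X v → 1 * (2 * X) + 2 * v + 0 ≡ 2 * X + 2 * v
      lhs = solve-∀
    outer-digits false X v = subst (_< 2 * X + 2 * suc v) (sym (lhs X v))
      (<-≤-trans (≤-reflexive (sym (*-suc 2 v))) (m≤n+m _ (2 * X)))
      where
      lhs : ∀ X v → 0 * (2 * X) + 2 * v + 1 ≡ suc (2 * v)
      lhs = solve-∀

  antipalindromic-antiVal : ∀ h → Antipalindromic (antiVal (true ∷ h))
  antipalindromic-antiVal h =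
    ≤-trans (≤-trans (m^n>0 4 (length h)) (m≤m+n _ _)) (2*4^length≤antiVal h) ,
    suc (length h) ,
    subst (λ w → length w ≡ 2 * suc (length h) × Complementary (2 * suc (length h)) w) (sym (binary-antiVal h))
      (length-antiWord (true ∷ h) , antiWord-complementary (true ∷ h))

  antipalindromic⇒antiVal : ∀ n → Antipalindromic n → ∃ λ h → n ≡ antiVal (true ∷ h)
  antipalindromic⇒antiVal n (1≤n , m , len , comp)
    with complementary⇒antiWord m (binary n) len comp | binaryAux-head n n 1≤n ≤-refl
  ... | true ∷ h , _ , antiWord≡ | _ = h , (begin
    n                              ≡⟨ fromBits-binaryAux n n ≤-refl ⟨
    fromBits (binary n)            ≡⟨ cong fromBits antiWord≡ ⟨
    fromBits (antiWord (true ∷ h)) ≡⟨ fromBits-antiWord (true ∷ h) ⟩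
    antiVal (true ∷ h)             ∎)
    where open ≡-Reasoning
  ... | false ∷ _ , _ , antiWord≡ | _ , binary≡ with () ← trans antiWord≡ binary≡
  ... | [] , _ , antiWord≡ | _ , binary≡ with () ← trans antiWord≡ binary≡

module Solutions where

  open Antipalindromes
  open import Data.Bool using (true)
  open import Data.List using (_∷_; length)
  open import Data.Nat using (zero; suc; _+_; _*_; _∸_; _^_; _≤_; _<_; z≤n; s≤s; >-nonZero)
  open import Data.Nat.Properties
  open import Data.Nat.Tactic.RingSolver using (solve-∀)
  open import Data.Product using (Σ; ∃; ∃₂; _×_; _,_)
  open import Data.Sum using (_⊎_; inj₁; inj₂)
  open import Relation.Binary.PropositionalEquality

  Solvable : ℕ → ℕ → ℕ → Set
  Solvable p q d = ∃₂ λ la lb → length lb ≡ length la + d × q * antiVal (true ∷ la) ≡ p * antiVal (true ∷ lb)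

  n<4^n : ∀ n → n < 4 ^ n
  n<4^n zero = s≤s z≤n
  n<4^n (suc n) = begin-strict
    suc n   ≡⟨ +-comm 1 n ⟩
    n + 1   <⟨ +-mono-<-≤ (n<4^n n) (m^n>0 4 n) ⟩
    X + X   ≤⟨ +-monoʳ-≤ X (m≤m+n X _) ⟩
    4 * X   ∎
    where
    open ≤-Reasoning
    X = 4 ^ n

  solvable⇒gap< : ∀ p q d → 1 ≤ p → Solvable p q d → d < 2 * q
  solvable⇒gap< p q d 1≤p (la , lb , len , eq) = begin-strict
    d          <⟨ n<4^n d ⟩
    Y          ≤⟨ m≤n*m Y p ⦃ >-nonZero 1≤p ⦄ ⟩
    p * Y      ≤⟨ *-cancelʳ-≤ (p * Y) (2 * q) (2 * X) ⦃ >-nonZero 1≤2X ⦄ scaled ⟩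
    2 * q      ∎
    where
    open ≤-Reasoning
    X = 4 ^ length la
    Y = 4 ^ d
    1≤2X : 1 ≤ 2 * X
    1≤2X = ≤-trans (m^n>0 4 (length la)) (m≤m+n X _)
    scaled : p * Y * (2 * X) ≤ 2 * q * (2 * X)
    scaled = begin
      p * Y * (2 * X)              ≡⟨ reorder p X Y ⟩
      p * (2 * (X * Y))            ≡⟨ cong (λ k → p * (2 * k)) (^-distribˡ-+-* 4 (length la) d) ⟨
      p * (2 * 4 ^ (length la + d)) ≤⟨ *-monoʳ-≤ p (subst (λ k → 2 * 4 ^ k ≤ antiVal (true ∷ lb)) len
                                                       (2*4^length≤antiVal lb)) ⟩
      p * antiVal (true ∷ lb)      ≡⟨ eq ⟨
      q * antiVal (true ∷ la)      ≤⟨ *-monoʳ-≤ q (<⇒≤ (antiVal<4^length (true ∷ la))) ⟩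
      q * (4 * X)                  ≡⟨ reorder′ q X ⟩
      2 * q * (2 * X)              ∎
      where
      reorder : ∀ p X Y → p * Y * (2 * X) ≡ p * (2 * (X * Y))
      reorder = solve-∀
      reorder′ : ∀ q X → q * (4 * X) ≡ 2 * q * (2 * X)
      reorder′ = solve-∀

  AntipalindromicRatio : ℕ → ℕ → Set
  AntipalindromicRatio p q = Σ ℕ (λ A → Σ ℕ (λ B → Antipalindromic A × Antipalindromic B × p * B ≡ A * q))

  BoundedSolvable : ℕ → ℕ → Set
  BoundedSolvable p q = (∃ λ d → d < 2 * q × Solvable p q d) ⊎ (∃ λ d → d < 2 * p × Solvable q p d)

  boundedSolvable⇒ratio : ∀ p q → BoundedSolvable p q → AntipalindromicRatio p q
  boundedSolvable⇒ratio _ q (inj₁ (_ , _ , la , lb , _ , eq)) =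
    antiVal (true ∷ la) , antiVal (true ∷ lb) , antipalindromic-antiVal la , antipalindromic-antiVal lb ,
    trans (sym eq) (*-comm q _)
  boundedSolvable⇒ratio _ q (inj₂ (_ , _ , la , lb , _ , eq)) =
    antiVal (true ∷ lb) , antiVal (true ∷ la) , antipalindromic-antiVal lb , antipalindromic-antiVal la ,
    trans eq (*-comm q _)

  ratio⇒boundedSolvable : ∀ {p q} → 1 ≤ p → 1 ≤ q → AntipalindromicRatio p q → BoundedSolvable p q
  ratio⇒boundedSolvable {p} {q} 1≤p 1≤q (A , B , anti-A , anti-B , eq)
    with la , refl ← antipalindromic⇒antiVal A anti-A
       | lb , refl ← antipalindromic⇒antiVal B anti-B
    with ≤-total (length la) (length lb)
  ... | inj₁ la≤lb = inj₁ (_ , solvable⇒gap< p q _ 1≤p sol , sol)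
    where
    sol : Solvable p q (length lb ∸ length la)
    sol = la , lb , sym (m+[n∸m]≡n la≤lb) , trans (*-comm q _) (sym eq)
  ... | inj₂ lb≤la = inj₂ (_ , solvable⇒gap< q p _ 1≤q sol , sol)
    where
    sol : Solvable q p (length la ∸ length lb)
    sol = lb , la , sym (m+[n∸m]≡n lb≤la) , trans eq (*-comm _ q)

module Integers where

  open import Data.Integer using (ℤ; +_; 0ℤ; _+_; _*_; _-_; -_; _≤_; +≤+; ∣_∣)
  import Data.Integer.Properties as ℤ
  open import Data.Integer.Tactic.RingSolver using (solve-∀)
  open import Data.List using (map; upTo)
  open import Data.List.Membership.Propositional using (_∈_)
  open import Data.List.Membership.Propositional.Properties using (∈-map⁺; ∈-upTo⁺)
  open import Data.Nat as ℕ using (suc; z≤n; s≤s)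
  open import Relation.Binary.PropositionalEquality

  interval : ℤ → ℤ → List ℤ
  interval lo hi = map (λ i → lo + + i) (upTo (suc ∣ hi - lo ∣))

  ∈-interval : ∀ {lo hi x} → lo ≤ x → x ≤ hi → x ∈ interval lo hi
  ∈-interval {lo} {hi} {x} lo≤x x≤hi =
    subst (_∈ interval lo hi) lo+[x-lo]≡x (∈-map⁺ (λ i → lo + + i) (∈-upTo⁺ (s≤s i≤n)))
    where
    offset : ∀ {y} → lo ≤ y → + ∣ y - lo ∣ ≡ y - lo
    offset lo≤y = ℤ.0≤i⇒+∣i∣≡i (ℤ.i≤j⇒0≤j-i lo≤y)
    lo+[x-lo]≡x : lo + + ∣ x - lo ∣ ≡ x
    lo+[x-lo]≡x = trans (cong (λ t → lo + t) (offset lo≤x)) (cancel lo x)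
      where
      cancel : ∀ lo x → lo + (x - lo) ≡ x
      cancel = solve-∀
    i≤n : ∣ x - lo ∣ ℕ.≤ ∣ hi - lo ∣
    i≤n = ℤ.drop‿+≤+ (subst₂ _≤_ (sym (offset lo≤x)) (sym (offset (ℤ.≤-trans lo≤x x≤hi)))
            (ℤ.+-monoˡ-≤ (- lo) x≤hi))

  ≤-via : ∀ {i j} n {l r} → 0ℤ ≤ n → l ≡ r → j - i ≡ n + (l - r) → i ≤ j
  ≤-via {i} {j} n {l} {r} 0≤n l≡r eq = ℤ.0≤i-j⇒j≤i (subst (0ℤ ≤_) (sym (begin
    j - i       ≡⟨ eq ⟩
    n + (l - r) ≡⟨ cong (λ t → n + t) (ℤ.i≡j⇒i-j≡0 l≡r) ⟩
    n + 0ℤ      ≡⟨ ℤ.+-identityʳ n ⟩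
    n           ∎)) 0≤n)
    where open ≡-Reasoning

  0≤pos : ∀ n → 0ℤ ≤ + n
  0≤pos n = +≤+ z≤n

  *-nonNeg : ∀ {i j} → 0ℤ ≤ i → 0ℤ ≤ j → 0ℤ ≤ i * j
  *-nonNeg {+ m} {+ n} _ _ = subst (0ℤ ≤_) (ℤ.pos-* m n) (0≤pos (m ℕ.* n))

module Carries (p q d : ℕ) where

  open Lists using (∃-Bool?; ∃-ofLength?)
  open Binary using (bit)
  open Antipalindromes using (antiVal; antiVal<4^length)
  open Solutions using (Solvable)
  open Integers
  open import Data.Bool using (Bool; true; false; not)
  open import Data.Integer using (ℤ; +_; 0ℤ; 1ℤ; _+_; _*_; _-_; -_; _≤_; +≤+)
  import Data.Integer.Properties as ℤ
  open import Data.Integer.Tactic.RingSolver using (solve-∀)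
  open import Data.List using ([]; _∷_; length; cartesianProduct)
  open import Data.List.Membership.Propositional.Properties using (∈-cartesianProduct⁺)
  open import Data.Nat as ℕ using (zero; suc; _^_; z≤n; s≤s)
  import Data.Nat.Properties as ℕ
  open import Data.Product using (∃; ∃₂; _×_; _,_)
  import Data.Product.Properties as Product
  open import Relation.Binary.PropositionalEquality
  open import Relation.Nullary.Decidable using (map′; _×-dec_)
  open import Relation.Unary using (Decidable)

  P Q : ℤ
  P = + p
  Q = + q

  pow4 : ℕ → ℤ
  pow4 n = + (4 ^ n)

  K : ℤ
  K = P * pow4 d

  bitℤ : Bool → ℤ
  bitℤ a = + bit a

  val : List Bool → ℤ
  val h = + antiVal h

  pow4-suc : ∀ n → pow4 (suc n) ≡ + 4 * pow4 n
  pow4-suc n = ℤ.pos-* 4 (4 ^ n)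

  pow4-+ : ∀ m n → pow4 (m ℕ.+ n) ≡ pow4 m * pow4 n
  pow4-+ m n = trans (cong +_ (ℕ.^-distribˡ-+-* 4 m n)) (ℤ.pos-* (4 ^ m) (4 ^ n))

  val-∷ : ∀ a h → val (a ∷ h) ≡ bitℤ a * (+ 2 * pow4 (length h)) + + 2 * val h + bitℤ (not a)
  val-∷ a h = begin
    + (x ℕ.+ y ℕ.+ bit (not a))     ≡⟨ ℤ.pos-+ (x ℕ.+ y) _ ⟩
    + (x ℕ.+ y) + bitℤ (not a)      ≡⟨ cong (_+ bitℤ (not a)) (ℤ.pos-+ x y) ⟩
    + x + + y + bitℤ (not a)        ≡⟨ cong₂ (λ u v → u + v + bitℤ (not a))
                                         (trans (ℤ.pos-* (bit a) _) (cong (bitℤ a *_) (ℤ.pos-* 2 (4 ^ length h))))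
                                         (ℤ.pos-* 2 (antiVal h)) ⟩
    bitℤ a * (+ 2 * pow4 (length h)) + + 2 * val h + bitℤ (not a) ∎
    where
    open ≡-Reasoning
    x = bit a ℕ.* (2 ℕ.* 4 ^ length h)
    y = 2 ℕ.* antiVal h

  val+1≤pow4 : ∀ h → val h + 1ℤ ≤ pow4 (length h)
  val+1≤pow4 h = subst (_≤ pow4 (length h)) (trans (cong +_ (ℕ.+-comm 1 (antiVal h))) (ℤ.pos-+ (antiVal h) 1))
    (+≤+ (antiVal<4^length h))

  defect : ℤ → List Bool → List Bool → ℤ
  defect H la lb = H * pow4 (length la) + Q * val la - P * val lb

  shift : ℤ → Bool → Bool → ℤ
  shift H a b = + 2 * H + Q * bitℤ a - K * bitℤ b

  carry : Bool → Bool → ℤ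
  carry a b = Q * bitℤ (not a) - P * bitℤ (not b)

  defect-∷ : ∀ H a b la lb → length lb ≡ length la ℕ.+ d →
    defect H (a ∷ la) (b ∷ lb) ≡ + 2 * defect (shift H a b) la lb + carry a b
  defect-∷ H a b la lb len = begin
    H * pow4 (suc (length la)) + Q * val (a ∷ la) - P * val (b ∷ lb)
      ≡⟨ cong₂ (λ u v → H * u + Q * v - P * val (b ∷ lb)) (pow4-suc (length la)) (val-∷ a la) ⟩
    H * (+ 4 * x) + Q * (A * (+ 2 * x) + + 2 * val la + A′) - P * val (b ∷ lb)
      ≡⟨ cong (λ v → H * (+ 4 * x) + Q * (A * (+ 2 * x) + + 2 * val la + A′) - P * v)
           (trans (val-∷ b lb) (cong (λ u → B * (+ 2 * u) + + 2 * val lb + B′)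
             (trans (cong pow4 len) (pow4-+ (length la) d)))) ⟩
    H * (+ 4 * x) + Q * (A * (+ 2 * x) + + 2 * val la + A′) - P * (B * (+ 2 * (x * y)) + + 2 * val lb + B′)
      ≡⟨ regroup H Q P x y A A′ B B′ (val la) (val lb) ⟩
    + 2 * ((+ 2 * H + Q * A - (P * y) * B) * x + Q * val la - P * val lb) + (Q * A′ - P * B′) ∎
    where
    open ≡-Reasoning
    x = pow4 (length la)
    y = pow4 d
    A = bitℤ a
    A′ = bitℤ (not a)
    B = bitℤ b
    B′ = bitℤ (not b)
    regroup : ∀ H Q P x y A A′ B B′ va vb →
      H * (+ 4 * x) + Q * (A * (+ 2 * x) + + 2 * va + A′) - P * (B * (+ 2 * (x * y)) + + 2 * vb + B′)
        ≡ + 2 * ((+ 2 * H + Q * A - (P * y) * B) * x + Q * va - P * vb) + (Q * A′ - P * B′)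
    regroup = solve-∀

  State : Set
  State = ℤ × ℤ

  -- H weighs the leading digits read so far and C carries the trailing ones; the remaining
  -- halves la, lb must satisfy H 4^s + q [la] + C = p [lb].
  Completable : State → ℕ → Set
  Completable (H , C) s = ∃₂ λ la lb → length la ≡ s × length lb ≡ s ℕ.+ d × defect H la lb + C ≡ 0ℤ

  Step : State → State → Set
  Step (H , C) (H′ , C′) = ∃₂ λ a b → H′ ≡ shift H a b × + 2 * C′ ≡ C + carry a b

  step⇒completable : ∀ {H C H′ C′ s} → Step (H , C) (H′ , C′) → Completable (H′ , C′) s →
    Completable (H , C) (suc s)
  step⇒completable {H} {C} {C′ = C′} (a , b , refl , 2C′≡) (la , lb , refl , len , eq) =
    a ∷ la , b ∷ lb , refl , cong suc len , (begin
      defect H (a ∷ la) (b ∷ lb) + C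
        ≡⟨ cong (_+ C) (defect-∷ H a b la lb len) ⟩
      + 2 * D + carry a b + C
        ≡⟨ regroup D (carry a b) C C′ ⟩
      + 2 * (D + C′) + (C + carry a b - + 2 * C′)
        ≡⟨ cong₂ (λ u v → + 2 * u + v) eq (ℤ.i≡j⇒i-j≡0 (sym 2C′≡)) ⟩
      0ℤ ∎)
    where
    open ≡-Reasoning
    D = defect (shift H a b) la lb
    regroup : ∀ D c C C′ → + 2 * D + c + C ≡ + 2 * (D + C′) + (C + c - + 2 * C′)
    regroup = solve-∀

  completable⇒step : ∀ {H C s} → Completable (H , C) (suc s) → ∃ λ st → Step (H , C) st × Completable st s
  completable⇒step {H} {C} (a ∷ la , b ∷ lb , refl , len , eq) =
    (shift H a b , - D) , (a , b , refl , 2C′≡) , la , lb , refl , ℕ.suc-injective len , ℤ.+-inverseʳ D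
    where
    open ≡-Reasoning
    D = defect (shift H a b) la lb
    regroup : ∀ D c C → + 2 * (- D) ≡ C + c - (+ 2 * D + c + C)
    regroup = solve-∀
    2C′≡ : + 2 * (- D) ≡ C + carry a b
    2C′≡ = begin
      + 2 * (- D)                                ≡⟨ regroup D (carry a b) C ⟩
      C + carry a b - (+ 2 * D + carry a b + C)  ≡⟨ cong (λ t → C + carry a b - t) vanishes ⟩
      C + carry a b - 0ℤ                         ≡⟨ ℤ.+-identityʳ _ ⟩
      C + carry a b                              ∎
      where
      vanishes : + 2 * D + carry a b + C ≡ 0ℤ
      vanishes = trans (sym (cong (_+ C) (defect-∷ H a b la lb (ℕ.suc-injective len)))) eq

  bitℤ≤1 : ∀ a → bitℤ a ≤ 1ℤ
  bitℤ≤1 true = +≤+ (s≤s z≤n)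
  bitℤ≤1 false = +≤+ z≤n

  carry-bounds : ∀ {C C′} a b → - P ≤ C → C ≤ Q → + 2 * C′ ≡ C + carry a b → - P ≤ C′ × C′ ≤ Q
  carry-bounds {C} {C′} a b lo hi 2C′≡ = halve lower , halve upper
    where
    lower-certificate : ∀ C C′ Q P A′ B′ →
      + 2 * C′ - + 2 * (- P) ≡ C - - P + Q * A′ + P * (1ℤ - B′) + (+ 2 * C′ - (C + (Q * A′ - P * B′)))
    lower-certificate = solve-∀
    upper-certificate : ∀ C C′ Q P A′ B′ →
      + 2 * Q - + 2 * C′ ≡ Q - C + Q * (1ℤ - A′) + P * B′ + (C + (Q * A′ - P * B′) - + 2 * C′)
    upper-certificate = solve-∀
    A′ = bitℤ (not a)
    B′ = bitℤ (not b)
    halve : ∀ {i j} → + 2 * i ≤ + 2 * j → i ≤ j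
    halve = ℤ.*-cancelˡ-≤-pos _ _ (+ 2)
    lower : + 2 * (- P) ≤ + 2 * C′
    lower = ≤-via (C - - P + Q * A′ + P * (1ℤ - B′))
      (ℤ.+-mono-≤ (ℤ.+-mono-≤ (ℤ.i≤j⇒0≤j-i lo) (*-nonNeg (0≤pos q) (0≤pos _)))
                  (*-nonNeg (0≤pos p) (ℤ.i≤j⇒0≤j-i (bitℤ≤1 (not b)))))
      2C′≡ (lower-certificate C C′ Q P A′ B′)
    upper : + 2 * C′ ≤ + 2 * Q
    upper = ≤-via (Q - C + Q * (1ℤ - A′) + P * B′)
      (ℤ.+-mono-≤ (ℤ.+-mono-≤ (ℤ.i≤j⇒0≤j-i hi) (*-nonNeg (0≤pos q) (ℤ.i≤j⇒0≤j-i (bitℤ≤1 (not a)))))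
                  (*-nonNeg (0≤pos p) (0≤pos _)))
      (sym 2C′≡) (upper-certificate C C′ Q P A′ B′)

  *-cancelʳ-≤-pow4 : ∀ {i j} n → i * pow4 n ≤ j * pow4 n → i ≤ j
  *-cancelʳ-≤-pow4 {i} {j} n le with 4 ^ n | ℕ.m^n>0 4 n
  ... | suc k | _ = ℤ.*-cancelʳ-≤-pos i j (+ suc k) le

  weight-bounds : ∀ {H C s} → - P ≤ C → C ≤ Q → Completable (H , C) s → - Q ≤ H × H ≤ K
  weight-bounds {H} {C} lo hi (la , lb , refl , len , eq) = cancel lower , cancel upper
    where
    lower-certificate : ∀ H C P Q x va vb →
      H * x - (- Q) * x ≡ P * vb + Q * (x - (va + 1ℤ)) + (Q - C) + (H * x + Q * va - P * vb + C - 0ℤ)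
    lower-certificate = solve-∀
    upper-certificate : ∀ H C P Q x y va vb →
      (P * y) * x - H * x ≡ P * (x * y - (vb + 1ℤ)) + Q * va + (C - - P) + (0ℤ - (H * x + Q * va - P * vb + C))
    upper-certificate = solve-∀
    x = pow4 (length la)
    y = pow4 d
    va = val la
    vb = val lb
    vb+1≤xy : vb + 1ℤ ≤ x * y
    vb+1≤xy = subst (vb + 1ℤ ≤_) (trans (cong pow4 len) (pow4-+ (length la) d)) (val+1≤pow4 lb)
    cancel : ∀ {i j} → i * x ≤ j * x → i ≤ j
    cancel = *-cancelʳ-≤-pow4 (length la)
    lower : - Q * x ≤ H * x
    lower = ≤-via (P * vb + Q * (x - (va + 1ℤ)) + (Q - C))
      (ℤ.+-mono-≤ (ℤ.+-mono-≤ (*-nonNeg (0≤pos p) (0≤pos _)) (*-nonNeg (0≤pos q) (ℤ.i≤j⇒0≤j-i (val+1≤pow4 la))))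
                  (ℤ.i≤j⇒0≤j-i hi))
      eq (lower-certificate H C P Q x va vb)
    upper : H * x ≤ K * x
    upper = ≤-via (P * (x * y - (vb + 1ℤ)) + Q * va + (C - - P))
      (ℤ.+-mono-≤ (ℤ.+-mono-≤ (*-nonNeg (0≤pos p) (ℤ.i≤j⇒0≤j-i vb+1≤xy)) (*-nonNeg (0≤pos q) (0≤pos _)))
                  (ℤ.i≤j⇒0≤j-i lo))
      (sym eq) (upper-certificate H C P Q x y va vb)

  space : List State
  space = cartesianProduct (interval (- Q) K) (interval (- P) Q)

  step? : ∀ st st′ → Dec (Step st st′)
  step? (H , C) (H′ , C′) =
    ∃-Bool? λ a → ∃-Bool? λ b → (H′ ℤ.≟ shift H a b) ×-dec (+ 2 * C′ ℤ.≟ C + carry a b)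

  final? : Decidable (λ st → Completable st 0)
  final? (H , C) = map′ (λ (lb , len , eq) → [] , lb , refl , len , eq)
                        (λ { ([] , lb , _ , len , eq) → lb , len , eq })
                        (∃-ofLength? (λ lb → defect H [] lb + C ℤ.≟ 0ℤ) d)

  open FiniteSearch (Product.≡-dec ℤ._≟_ ℤ._≟_) Step step? (λ st → Completable st 0) final? space

  run⇒completable : ∀ {H C s} → Run (H , C) s → Completable (H , C) s
  run⇒completable (done w) = w
  run⇒completable {H} {C} (step {t = H′ , C′} st _ r) = step⇒completable {H} {C} {H′} {C′} st (run⇒completable r)

  completable⇒run : ∀ {H C s} → - P ≤ C → C ≤ Q → Completable (H , C) s → Run (H , C) s
  completable⇒run {s = zero} _ _ w = done w
  completable⇒run {H} {C} {suc s} lo hi w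
    with (H′ , C′) , st@(a , b , _ , 2C′≡) , w′ ← completable⇒step {H} {C} w
    with lo′ , hi′ ← carry-bounds a b lo hi 2C′≡
    with H-lo , H-hi ← weight-bounds {H′} lo′ hi′ w′
    = step st (∈-cartesianProduct⁺ (∈-interval H-lo H-hi) (∈-interval lo′ hi′)) (completable⇒run lo′ hi′ w′)

  -- The state after reading the leading 1s of both halves.
  initial : State
  initial = shift 0ℤ true true , 0ℤ

  solution-defect : ∀ la lb → length lb ≡ length la ℕ.+ d →
    + (q ℕ.* antiVal (true ∷ la)) - + (p ℕ.* antiVal (true ∷ lb)) ≡ + 2 * (defect (shift 0ℤ true true) la lb + 0ℤ)
  solution-defect la lb len = begin
    + (q ℕ.* antiVal (true ∷ la)) - + (p ℕ.* antiVal (true ∷ lb))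
      ≡⟨ cong₂ _-_ (ℤ.pos-* q _) (ℤ.pos-* p _) ⟩
    Q * val (true ∷ la) - P * val (true ∷ lb)
      ≡⟨ no-leading-term Q P (pow4 (suc (length la))) (val (true ∷ la)) (val (true ∷ lb)) ⟩
    defect 0ℤ (true ∷ la) (true ∷ lb)
      ≡⟨ defect-∷ 0ℤ true true la lb len ⟩
    + 2 * D + (Q * 0ℤ - P * 0ℤ)
      ≡⟨ no-carry D Q P ⟩
    + 2 * (D + 0ℤ) ∎
    where
    open ≡-Reasoning
    D = defect (shift 0ℤ true true) la lb
    no-leading-term : ∀ Q P x va vb → Q * va - P * vb ≡ 0ℤ * x + Q * va - P * vb
    no-leading-term = solve-∀
    no-carry : ∀ D Q P → + 2 * D + (Q * 0ℤ - P * 0ℤ) ≡ + 2 * (D + 0ℤ)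
    no-carry = solve-∀

  solvable⇒completable : Solvable p q d → ∃ (Completable initial)
  solvable⇒completable (la , lb , len , eq) = length la , la , lb , refl , len ,
    ℤ.*-cancelˡ-≡ (+ 2) _ 0ℤ (trans (sym (solution-defect la lb len)) (ℤ.i≡j⇒i-j≡0 (cong +_ eq)))

  completable⇒solvable : ∃ (Completable initial) → Solvable p q d
  completable⇒solvable (_ , la , lb , refl , len , eq) = la , lb , len ,
    ℤ.+-injective (ℤ.i-j≡0⇒i≡j _ _ (trans (solution-defect la lb len) (cong (+ 2 *_) eq)))

  solvable? : Dec (Solvable p q d)
  solvable? = map′ (λ (_ , r) → completable⇒solvable (_ , run⇒completable r)) toRun (∃run? initial)
    where
    toRun : Solvable p q d → ∃ (Run initial)
    toRun sol with s , w ← solvable⇒completable sol = s , completable⇒run (ℤ.neg-mono-≤ (0≤pos p)) (0≤pos q) w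

open Solutions using (boundedSolvable⇒ratio; ratio⇒boundedSolvable)
open import Data.Nat using (_*_; _≤_)
open import Data.Nat.Properties using (anyUpTo?)
open import Data.Product using (Σ; _×_)
open import Relation.Binary.PropositionalEquality using (_≡_)
open import Relation.Nullary.Decidable using (map′; _⊎-dec_)

theorem23 : (p q : ℕ) → 1 ≤ p → 1 ≤ q →
    Dec (Σ ℕ (λ A → Σ ℕ (λ B →
    Antipalindromic A × Antipalindromic B × p * B ≡ A * q)))
theorem23 p q 1≤p 1≤q = map′ (boundedSolvable⇒ratio p q) (ratio⇒boundedSolvable 1≤p 1≤q)
  (anyUpTo? (Carries.solvable? p q) (2 * q) ⊎-dec anyUpTo? (Carries.solvable? q p) (2 * p))
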